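{- Fix a positive integer $b$ and let $(x,y,z)$ be positive integers with $(x+y+z)^2 = bxyz$ and $x\le y\le z\le x+y$. Then $(b,x,y,z)$ is one of the following thirteen $4$-tuples: $(1,5,20,25)$, $(1,6,12,18)$, $(1,8,8,16)$, $(1,9,9,9)$, $(2,3,6,9)$, $(2,4,4,8)$, $(3,2,4,6)$, $(3,3,3,3)$, $(4,2,2,4)$, $(5,1,4,5)$, $(6,1,2,3)$, $(8,1,1,2)$, $(9,1,1,1)$. -}

module Defs where

open import Data.Nat using (ℕ)
open import Data.Product using (_×_; _,_)
open import Data.List using (List; _∷_; [])

solutionTuples : List (ℕ × ℕ × ℕ × ℕ)
solutionTuples =
  (1 , 5 , 20 , 25) ∷ (1 , 6 , 12 , 18) ∷ (1 , 8 , 8 , 16) ∷ (1 , 9 , 9 , 9) ∷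
  (2 , 3 , 6 , 9) ∷ (2 , 4 , 4 , 8) ∷ (3 , 2 , 4 , 6) ∷ (3 , 3 , 3 , 3) ∷
  (4 , 2 , 2 , 4) ∷ (5 , 1 , 4 , 5) ∷ (6 , 1 , 2 , 3) ∷ (8 , 1 , 1 , 2) ∷
  (9 , 1 , 1 , 1) ∷ []

{-# OPTIONS --safe #-}
module Submission where

-- With s = x + y + z we have b x y² ≤ b x y z = s² ≤ 4 (x + y)² ≤ 16 y², so b x ≤ 16;
-- and s² > (y + z)² ≥ 4 y z gives b x ≥ 5, whence 5 y² ≤ s² ≤ 4 (x + y)², which forces
-- y ≤ 9 x.  This leaves finitely many candidates (b, x, y, z), all decided by computation.

open import Defs
open import Data.Nat using (ℕ; _+_; _*_; _^_; _≤_; _<_; suc; z<s; s≤s; _≤?_; _<?_; _≟_)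
open import Data.Nat.Properties
open import Data.Nat.Solver using (module +-*-Solver)
open import Data.Product using (_,_)
open import Data.Product.Properties using (≡-dec)
open import Data.Sum using (inj₁; inj₂)
open import Data.List.Membership.Propositional using (_∈_)
open import Data.List.Membership.DecPropositional (≡-dec _≟_ (≡-dec _≟_ (≡-dec _≟_ _≟_)))
  using (_∈?_)
open import Relation.Nullary using (Dec)
open import Relation.Nullary.Decidable using (_→-dec_; from-yes)
open import Relation.Binary.PropositionalEquality
  using (_≡_; refl; sym; trans; cong; subst; subst₂)

open +-*-Solver using (solve; _:+_; _:*_; _:^_; _:=_; con)
open ≤-Reasoning

[m+m]²≡4m² : ∀ m → (m + m) ^ 2 ≡ 4 * m ^ 2
[m+m]²≡4m² = solve 1 (λ m → (m :+ m) :^ 2 := con 4 :* m :^ 2) refl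

[m+[m+n]]²≡4m[m+n]+n² : ∀ m n → (m + (m + n)) ^ 2 ≡ 4 * (m * (m + n)) + n ^ 2
[m+[m+n]]²≡4m[m+n]+n² =
  solve 2 (λ m n → (m :+ (m :+ n)) :^ 2 := con 4 :* (m :* (m :+ n)) :+ n :^ 2) refl

4mn≤[m+n]²-ordered : ∀ {m n} → m ≤ n → 4 * (m * n) ≤ (m + n) ^ 2
4mn≤[m+n]²-ordered {m} m≤n with k , refl ← m≤n⇒∃[o]m+o≡n m≤n =
  subst (4 * (m * (m + k)) ≤_) (sym ([m+[m+n]]²≡4m[m+n]+n² m k)) (m≤m+n _ (k ^ 2))

4mn≤[m+n]² : ∀ m n → 4 * (m * n) ≤ (m + n) ^ 2
4mn≤[m+n]² m n with ≤-total m n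
... | inj₁ m≤n = 4mn≤[m+n]²-ordered m≤n
... | inj₂ n≤m = subst₂ _≤_ (cong (4 *_) (*-comm n m)) (cong (_^ 2) (+-comm n m))
                   (4mn≤[m+n]²-ordered n≤m)

-- 5 n² - 4 (m + n)² = n (n - 8 m) - 4 m², which is positive once n ≥ 9 m + 1.
9m<n⇒4[m+n]²<5n² : ∀ m {n} → 9 * m < n → 4 * (m + n) ^ 2 < 5 * n ^ 2
9m<n⇒4[m+n]²<5n² m 9m<n with t , refl ← m≤n⇒∃[o]m+o≡n 9m<n =
  subst (4 * (m + (suc (9 * m) + t)) ^ 2 <_) (sym (expand m t)) (m<m+n _ z<s)
  where
  expand : ∀ m t → 5 * (suc (9 * m) + t) ^ 2 ≡
    4 * (m + (suc (9 * m) + t)) ^ 2 + suc (5 * m * m + 10 * m + 10 * m * t + 2 * t + t * t)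
  expand = solve 2 (λ m t → con 5 :* (con 1 :+ con 9 :* m :+ t) :^ 2 :=
    con 4 :* (m :+ (con 1 :+ con 9 :* m :+ t)) :^ 2 :+
    (con 1 :+ con 5 :* m :* m :+ con 10 :* m :+ con 10 :* m :* t :+ con 2 :* t :+ t :* t)) refl

[x+y+z]²≤4[x+y]² : ∀ x y {z} → z ≤ x + y → (x + y + z) ^ 2 ≤ 4 * (x + y) ^ 2
[x+y+z]²≤4[x+y]² x y {z} z≤x+y = begin
  (x + y + z) ^ 2       ≤⟨ ^-monoˡ-≤ 2 (+-monoʳ-≤ (x + y) z≤x+y) ⟩
  (x + y + (x + y)) ^ 2 ≡⟨ [m+m]²≡4m² (x + y) ⟩
  4 * (x + y) ^ 2       ∎

IsSolution : ℕ → ℕ → ℕ → ℕ → Set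
IsSolution b x y z = (x + y + z) ^ 2 ≡ b * x * y * z

solution⇒bx*yz≡s² : ∀ b x y z → IsSolution b x y z → b * x * (y * z) ≡ (x + y + z) ^ 2
solution⇒bx*yz≡s² b x y z eq = sym (trans eq (*-assoc (b * x) y z))

solution⇒bxy²≤s² : ∀ b x y z → y ≤ z → IsSolution b x y z → b * x * y ^ 2 ≤ (x + y + z) ^ 2
solution⇒bxy²≤s² b x y z y≤z eq = begin
  b * x * y ^ 2     ≤⟨ *-monoʳ-≤ (b * x) (*-monoʳ-≤ y (subst (_≤ z) (sym (*-identityʳ y)) y≤z)) ⟩
  b * x * (y * z)   ≡⟨ solution⇒bx*yz≡s² b x y z eq ⟩
  (x + y + z) ^ 2   ∎

solution⇒bx≤16 : ∀ b x y z → 0 < y → x ≤ y → y ≤ z → z ≤ x + y → IsSolution b x y z →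
  b * x ≤ 16
solution⇒bx≤16 b x y@(suc _) z _ x≤y y≤z z≤x+y eq = *-cancelʳ-≤ (b * x) 16 (y ^ 2) (begin
  b * x * y ^ 2   ≤⟨ solution⇒bxy²≤s² b x y z y≤z eq ⟩
  (x + y + z) ^ 2 ≤⟨ [x+y+z]²≤4[x+y]² x y z≤x+y ⟩
  4 * (x + y) ^ 2 ≤⟨ *-monoʳ-≤ 4 (^-monoˡ-≤ 2 (+-monoˡ-≤ y x≤y)) ⟩
  4 * (y + y) ^ 2 ≡⟨ cong (4 *_) ([m+m]²≡4m² y) ⟩
  4 * (4 * y ^ 2) ≡⟨ *-assoc 4 4 (y ^ 2) ⟨
  16 * y ^ 2      ∎)

solution⇒4<bx : ∀ b x y z → 0 < x → IsSolution b x y z → 4 < b * x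
solution⇒4<bx b x y z 0<x eq = *-cancelʳ-< (y * z) 4 (b * x) (begin-strict
  4 * (y * z)     ≤⟨ 4mn≤[m+n]² y z ⟩
  (y + z) ^ 2     <⟨ ^-monoˡ-< 2 (subst (y + z <_) (sym (+-assoc x y z)) (m<n+m (y + z) 0<x)) ⟩
  (x + y + z) ^ 2 ≡⟨ solution⇒bx*yz≡s² b x y z eq ⟨
  b * x * (y * z) ∎)

solution⇒y≤9x : ∀ b x y z → 4 < b * x → y ≤ z → z ≤ x + y → IsSolution b x y z → y ≤ 9 * x
solution⇒y≤9x b x y z 4<bx y≤z z≤x+y eq = ≮⇒≥ λ 9x<y → <⇒≱ (9m<n⇒4[m+n]²<5n² x 9x<y) (begin
  5 * y ^ 2       ≤⟨ *-monoˡ-≤ (y ^ 2) 4<bx ⟩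
  b * x * y ^ 2   ≤⟨ solution⇒bxy²≤s² b x y z y≤z eq ⟩
  (x + y + z) ^ 2 ≤⟨ [x+y+z]²≤4[x+y]² x y z≤x+y ⟩
  4 * (x + y) ^ 2 ∎)

Listed : ℕ → ℕ → ℕ → ℕ → Set
Listed b x y z = IsSolution b x y z → (b , x , y , z) ∈ solutionTuples

listed? : ∀ b x y z → Dec (Listed b x y z)
listed? b x y z = (x + y + z) ^ 2 ≟ b * x * y * z →-dec (b , x , y , z) ∈? solutionTuples

BoundedSolutionsListed : Set
BoundedSolutionsListed =
  ∀ {b} → b < 17 → ∀ {x} → x < 17 → 4 < b * x → b * x ≤ 16 →
  ∀ {y} → y < suc (9 * x) → x ≤ y → ∀ {q} → q < suc x → Listed b x y (y + q)

boundedSolutionsListed : BoundedSolutionsListed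
boundedSolutionsListed = from-yes
  (allUpTo? (λ b → allUpTo? (λ x → 4 <? b * x →-dec b * x ≤? 16 →-dec
    allUpTo? (λ y → x ≤? y →-dec allUpTo? (λ q → listed? b x y (y + q)) (suc x))
      (suc (9 * x))) 17) 17)

theorem5p5 : (b x y z : ℕ) → 0 < b → 0 < x → 0 < y → 0 < z →
    (x + y + z) ^ 2 ≡ b * x * y * z →
    x ≤ y → y ≤ z → z ≤ x + y →
    (b , x , y , z) ∈ solutionTuples
theorem5p5 b@(suc _) x@(suc _) y z _ 0<x 0<y _ eq x≤y y≤z z≤x+y
  with q , refl ← m≤n⇒∃[o]m+o≡n y≤z =
  boundedSolutionsListed (s≤s b≤16) (s≤s x≤16) 4<bx bx≤16 (s≤s y≤9x) x≤y (s≤s q≤x) eq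
  where
  bx≤16 : b * x ≤ 16
  bx≤16 = solution⇒bx≤16 b x y (y + q) 0<y x≤y y≤z z≤x+y eq
  b≤16 : b ≤ 16
  b≤16 = ≤-trans (m≤m*n b x) bx≤16
  x≤16 : x ≤ 16
  x≤16 = ≤-trans (m≤n*m x b) bx≤16
  4<bx : 4 < b * x
  4<bx = solution⇒4<bx b x y (y + q) 0<x eq
  y≤9x : y ≤ 9 * x
  y≤9x = solution⇒y≤9x b x y (y + q) 4<bx y≤z z≤x+y eq
  q≤x : q ≤ x
  q≤x = +-cancelˡ-≤ y q x (subst (y + q ≤_) (+-comm x y) z≤x+y)
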